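{- Let $J\subseteq C(n,k)$ be a realizable $k$-set and let $Y\in C(n,k+2)$. Write $A<B$ if every element of $A$ is lexicographically smaller than every element of $B$. Then $P_Y$ is the union of the sets $P_Y\cap J_s$, $P_Y\cap J_p$, $P_Y\cap J_F$, $P_Y\cap J_\emptyset$, and these are arranged in one of the following four ways (some pieces possibly empty, the omitted piece being empty): (i) $P_Y\cap J_s<P_Y\cap J_F<P_Y\cap J_p$; (ii) $P_Y\cap J_p<P_Y\cap J_F<P_Y\cap J_s$; (iii) $P_Y\cap J_s<P_Y\cap J_\emptyset<P_Y\cap J_p$; (iv) $P_Y\cap J_p<P_Y\cap J_\emptyset<P_Y\cap J_s$.
   Context: $C(n,m)$: $m$-subsets of $\{1,\dots,n\}$ with lexicographic order on increasing sequences. For $X\in C(n,m+1)$, $P_X=\{Z\in C(n,m):Z\subset X\}$ with induced lexicographic order; prefix/suffix = initial/final segment (possibly empty or all). For $A\subseteq C(n,k)$ define subsets of $C(n,k+1)$: $A_p$ (resp. $A_s$) = $\{X:P_X\cap A$ a nonempty prefix (resp. suffix) of $P_X$, $\ne P_X\}$, $A_F=\{X:P_X\subseteq A\}$, $A_\emptyset=\{X:P_X\cap A=\emptyset\}$. $A$ is a realizable $k$-set if $P_X\cap A$ is a prefix or suffix of $P_X$ for every $X\in C(n,k+1)$. -}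

module Defs where

open import Data.Nat using (ℕ; suc; _<_; _≤_)
open import Data.Bool using (Bool; true; false)
open import Data.List using (List; []; _∷_; length)
open import Data.List.Membership.Propositional using (_∈_)
open import Data.List.Relation.Unary.All using (All)
open import Data.List.Relation.Unary.Linked using (Linked)
open import Data.Product using (_×_; ∃)
open import Data.Sum using (_⊎_)
open import Relation.Binary.PropositionalEquality using (_≡_)
open import Relation.Nullary using (¬_)

-- An m-subset of {1,…,n} is represented by its elements listed in
-- strictly increasing order.
Comb : ℕ → ℕ → List ℕ → Set
Comb n m X = Linked _<_ X × All (λ x → 1 ≤ x × x ≤ n) X × length X ≡ m

data _<L_ : List ℕ → List ℕ → Set where
  nil  : ∀ {y ys} → [] <L (y ∷ ys)
  here : ∀ {x y xs ys} → x < y → (x ∷ xs) <L (y ∷ ys)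
  there : ∀ {x xs ys} → xs <L ys → (x ∷ xs) <L (x ∷ ys)

Subset : Set
Subset = List ℕ → Bool

-- Z ∈ P_X, where X ∈ C(n,m+1) and Z ∈ C(n,m).
InP : ℕ → ℕ → List ℕ → List ℕ → Set
InP n m X Z = Comb n m Z × (∀ z → z ∈ Z → z ∈ X)

IsPrefix : ℕ → ℕ → Subset → List ℕ → Set
IsPrefix n k A X = ∀ Z Z′ → InP n k X Z → InP n k X Z′ → Z′ <L Z → A Z ≡ true → A Z′ ≡ true

IsSuffix : ℕ → ℕ → Subset → List ℕ → Set
IsSuffix n k A X = ∀ Z Z′ → InP n k X Z → InP n k X Z′ → Z <L Z′ → A Z ≡ true → A Z′ ≡ true

NonEmptyIn : ℕ → ℕ → Subset → List ℕ → Set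
NonEmptyIn n k A X = ∃ λ Z → InP n k X Z × A Z ≡ true

NotAllIn : ℕ → ℕ → Subset → List ℕ → Set
NotAllIn n k A X = ∃ λ Z → InP n k X Z × A Z ≡ false

Aₚ : ℕ → ℕ → Subset → List ℕ → Set
Aₚ n k A X = IsPrefix n k A X × NonEmptyIn n k A X × NotAllIn n k A X

Aₛ : ℕ → ℕ → Subset → List ℕ → Set
Aₛ n k A X = IsSuffix n k A X × NonEmptyIn n k A X × NotAllIn n k A X

A_F : ℕ → ℕ → Subset → List ℕ → Set
A_F n k A X = ∀ Z → InP n k X Z → A Z ≡ true

A∅ : ℕ → ℕ → Subset → List ℕ → Set
A∅ n k A X = ∀ Z → InP n k X Z → A Z ≡ false

-- A is a realizable k-set (A ⊆ C(n,k); only its values on C(n,k) matter).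
Realizable : ℕ → ℕ → Subset → Set
Realizable n k A = ∀ X → Comb n (suc k) X → IsPrefix n k A X ⊎ IsSuffix n k A X

Before : ℕ → ℕ → List ℕ → (List ℕ → Set) → (List ℕ → Set) → Set
Before n m Y Q R = ∀ X X′ → InP n m Y X → InP n m Y X′ → Q X → R X′ → X <L X′

Arranged : ℕ → ℕ → List ℕ → (Q R S O : List ℕ → Set) → Set
Arranged n m Y Q R S O =
  Before n m Y Q R × Before n m Y R S × Before n m Y Q S
  × (∀ X → InP n m Y X → ¬ O X)

{-# OPTIONS --safe #-}
-- For Y ∈ C(n,k+2) the elements of P_Y are the sets Y∖r (r ∈ Y), and the elements of P_{Y∖r}
-- are the sets Y∖{r,w}. So J gives a symmetric Boolean matrix on Y, entry r w = J(Y∖{r,w}),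
-- and realizability says that every row, read along Y, is upward or downward closed.
-- Rank each row: 0 if it is a suffix row, 1 if it is constant, 2 if it is a prefix row.
-- For rows x < y < z the rank never has a peak or a valley: in each such configuration
-- some fourth row reads b, ¬ b, b at x, y, z, which a monotone row cannot do; complementing
-- the matrix, and additionally reversing the order, cut the configurations down to two.
-- A rank function on a chain without peaks and valleys is monotone, and that is the
-- arrangement. Finally a full row and an empty row would share an entry, so they never coexist.
module Submission where

open import Defs
open import Level using (0ℓ)
open import Data.Bool using (Bool; true; false; not) renaming (_≟_ to _≟ᵇ_)
open import Data.Bool.Properties using (not-¬; ¬-not; not-involutive)
open import Data.Nat using (ℕ; suc; _<_; _≤_; z≤n; s≤s; z<s; s<s; _≟_)
open import Data.Nat.Properties
  using ( <-isStrictTotalOrder; <-trans; <-irrefl; <-asym; <⇒≢; >⇒≢; <⇒≱; ≮⇒≥; ≤⇒≯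
        ; <-≤-trans; ≤-<-trans; suc-injective)
  renaming (_<?_ to _<ℕ?_)
open import Data.List using (List; []; _∷_; length; filter)
open import Data.List.Properties using (filter-accept; filter-reject; filter-all)
open import Data.List.Membership.Propositional using (_∈_; find; lose)
open import Data.List.Membership.Propositional.Properties using (∈-filter⁺; ∈-filter⁻)
open import Data.List.Membership.DecPropositional _≟_ using (_∈?_)
open import Data.List.Relation.Unary.Any using (Any; any?; here; there)
open import Data.List.Relation.Unary.All as All using (All; []; _∷_; all?)
import Data.List.Relation.Unary.All.Properties as All
open import Data.List.Relation.Unary.AllPairs using (AllPairs; _∷_)
open import Data.List.Relation.Unary.Linked using (Linked; _∷_)
import Data.List.Relation.Unary.Linked.Properties as Linked
open import Data.List.Relation.Binary.Sublist.Propositional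
  using (minimum; _∷_; _∷ʳ_) renaming (_⊆_ to _⊑_)
open import Data.List.Relation.Binary.Sublist.Propositional.Properties using (to-≋)
open import Data.List.Relation.Binary.Equality.Propositional using (≋⇒≡)
open import Data.Product using (_×_; _,_; ∃; proj₁; proj₂)
open import Data.Sum as Sum using (_⊎_; inj₁; inj₂; swap)
open import Data.Empty using (⊥; ⊥-elim)
open import Function using (flip; _∘_)
open import Relation.Binary using (Rel; IsStrictTotalOrder; Tri; tri<; tri≈; tri>)
import Relation.Binary.Construct.Flip.EqAndOrd as Flip
open import Relation.Binary.PropositionalEquality
  using (_≡_; _≢_; refl; sym; trans; cong; subst; subst₂)
open import Relation.Nullary using (¬_; Dec; yes; no; ¬?; contradiction; _×-dec_; _→-dec_)
open import Relation.Nullary.Decidable using (map′)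

contraposeᵇ : ∀ {x y : Bool} → (x ≡ true → y ≡ true) → y ≡ false → x ≡ false
contraposeᵇ {false} _ _ = refl
contraposeᵇ {true} x⇒y y≡false = contradiction (x⇒y refl) (not-¬ y≡false)

not-contraposeᵇ : ∀ {x y : Bool} → (x ≡ true → y ≡ true) → not y ≡ true → not x ≡ true
not-contraposeᵇ {false} _ _ = refl
not-contraposeᵇ {true} {false} x⇒y _ = contradiction (x⇒y refl) λ ()
not-contraposeᵇ {true} {true} _ ()

module Rows {A : Set} (_≺_ : Rel A 0ℓ) (Dom : A → Set) (entry : A → A → Bool) where

  Off : A → A → Set
  Off r w = Dom w × w ≢ r

  Up Down : A → Set
  Up r = ∀ {w w′} → Off r w → Off r w′ → w ≺ w′ → entry r w ≡ true → entry r w′ ≡ true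
  Down r = ∀ {w w′} → Off r w → Off r w′ → w ≺ w′ → entry r w′ ≡ true → entry r w ≡ true

  Constant Attains : Bool → A → Set
  Constant b r = ∀ {w} → Off r w → entry r w ≡ b
  Attains b r = ∃ λ w → Off r w × entry r w ≡ b

  Mixed Prefix Suffix : A → Set
  Mixed r = ∀ b → Attains b r
  Prefix r = Up r × Mixed r
  Suffix r = Down r × Mixed r

  RowsMonotone : Set
  RowsMonotone = ∀ r → Dom r → Up r ⊎ Down r

  -- The index is the position of the class in the arrangements: A_s, then A_F or A_∅, then A_p.
  data Kind (r : A) : ℕ → Set where
    suffix   : Suffix r → Kind r 0
    constant : ∀ b → Constant b r → Kind r 1
    prefix   : Prefix r → Kind r 2

-- Complementing the entries exchanges Up and Down rows; reversing the order as well exchanges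
-- them back, so Rᶜ keeps prefix and suffix rows and only exchanges full and empty ones.
module Duality {A : Set} (_≺_ : Rel A 0ℓ) (Dom : A → Set) (entry : A → A → Bool) where
  open Rows _≺_ Dom entry

  complement : A → A → Bool
  complement x y = not (entry x y)

  module Cᶜ = Rows _≺_ Dom complement
  module Rᶜ = Rows (flip _≺_) Dom complement

  module _ {r : A} where
    up⇒downᶜ : Up r → Cᶜ.Down r
    up⇒downᶜ up ow ow′ w≺w′ = not-contraposeᵇ (up ow ow′ w≺w′)

    down⇒upᶜ : Down r → Cᶜ.Up r
    down⇒upᶜ down ow ow′ w≺w′ = not-contraposeᵇ (down ow ow′ w≺w′)

    up⇒upʳ : Up r → Rᶜ.Up r
    up⇒upʳ up ow ow′ w′≺w = not-contraposeᵇ (up ow′ ow w′≺w)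

    down⇒downʳ : Down r → Rᶜ.Down r
    down⇒downʳ down ow ow′ w′≺w = not-contraposeᵇ (down ow′ ow w′≺w)

    constantᶜ : ∀ {b} → Constant b r → Cᶜ.Constant (not b) r
    constantᶜ const ow = cong not (const ow)

    mixedᶜ : Mixed r → Cᶜ.Mixed r
    mixedᶜ mixed b with mixed (not b)
    ... | w , ow , e = w , ow , trans (cong not e) (not-involutive b)

    prefix⇒suffixᶜ : Prefix r → Cᶜ.Suffix r
    prefix⇒suffixᶜ (up , mixed) = up⇒downᶜ up , mixedᶜ mixed

    suffix⇒prefixᶜ : Suffix r → Cᶜ.Prefix r
    suffix⇒prefixᶜ (down , mixed) = down⇒upᶜ down , mixedᶜ mixed

    suffix⇒suffixʳ : Suffix r → Rᶜ.Suffix r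
    suffix⇒suffixʳ (down , mixed) = down⇒downʳ down , mixedᶜ mixed

  symmetricᶜ : (∀ x y → entry x y ≡ entry y x) → ∀ x y → complement x y ≡ complement y x
  symmetricᶜ sym x y = cong not (sym x y)

  monotoneᶜ : RowsMonotone → Cᶜ.RowsMonotone
  monotoneᶜ mono r dr = swap (Sum.map up⇒downᶜ down⇒upᶜ (mono r dr))

  monotoneʳ : RowsMonotone → Rᶜ.RowsMonotone
  monotoneʳ mono r dr = Sum.map up⇒upʳ down⇒downʳ (mono r dr)

module RowLemmas {A : Set} {_≺_ : Rel A 0ℓ} (sto : IsStrictTotalOrder _≡_ _≺_)
  {Dom : A → Set} {entry : A → A → Bool}
  (entry-sym : ∀ x y → entry x y ≡ entry y x)
  (monotone : Rows.RowsMonotone _≺_ Dom entry) where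

  open Rows _≺_ Dom entry
  open IsStrictTotalOrder sto using (compare)
    renaming (_≟_ to _≟ᴬ_; trans to ≺-trans; irrefl to ≺-irrefl; asym to ≺-asym)

  private variable
    b : Bool
    r v w x y z h : A

  ≺⇒≢ : x ≺ y → x ≢ y
  ≺⇒≢ x≺y refl = ≺-irrefl refl x≺y

  ≻⇒≢ : y ≺ x → x ≢ y
  ≻⇒≢ y≺x refl = ≺-irrefl refl y≺x

  transpose : entry x y ≡ b → entry y x ≡ b
  transpose {x} {y} e = trans (sym (entry-sym x y)) e

  down-false : Down r → Off r v → Off r w → v ≺ w → entry r v ≡ false → entry r w ≡ false
  down-false down ov ow v≺w = contraposeᵇ (down ov ow v≺w)

  up-false-below : Up r → Off r v → Off r w → entry r v ≡ true → entry r w ≡ false → w ≺ v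
  up-false-below {v = v} {w} up ov ow ev ew with compare w v
  ... | tri< w≺v _ _ = w≺v
  ... | tri≈ _ refl _ = contradiction ev (not-¬ ew)
  ... | tri> _ _ v≺w = contradiction (up ov ow v≺w ev) (not-¬ ew)

  down-false-above : Down r → Off r v → Off r w → entry r v ≡ true → entry r w ≡ false → v ≺ w
  down-false-above {v = v} {w} down ov ow ev ew with compare v w
  ... | tri< v≺w _ _ = v≺w
  ... | tri≈ _ refl _ = contradiction ev (not-¬ ew)
  ... | tri> _ _ w≺v = contradiction (down ow ov w≺v ev) (not-¬ ew)

  constant⇒up : Constant b r → Up r
  constant⇒up const ow ow′ _ ew = trans (const ow′) (trans (sym (const ow)) ew)

  constant⇒down : Constant b r → Down r
  constant⇒down const ow ow′ _ ew′ = trans (const ow) (trans (sym (const ow′)) ew′)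

  mixed-not-constant : Mixed r → Constant b r → ⊥
  mixed-not-constant {b = b} mixed const with mixed (not b)
  ... | w , ow , e = not-¬ (const ow) e

  up-down-not-mixed : Up r → Down r → Mixed r → ⊥
  up-down-not-mixed up down mixed with mixed true | mixed false
  ... | t , ot , et | f , of , ef =
    ≺-asym (down-false-above down ot of et ef) (up-false-below up ot of et ef)

  full-empty-exclusive : Dom x → Dom z → ∃ (Off x) → Constant true x → Constant false z → ⊥
  full-empty-exclusive {x} {z} dx dz (w , ow) full-x empty-z with x ≟ᴬ z
  ... | yes refl = not-¬ (full-x ow) (empty-z ow)
  ... | no x≢z = not-¬ (full-x (dz , x≢z ∘ sym)) (transpose (empty-z (dx , x≢z)))

  no-dip : ∀ b → Dom r → Off r x → Off r y → Off r z → x ≺ y → y ≺ z →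
           entry r x ≡ b → entry r y ≡ not b → entry r z ≡ b → ⊥
  no-dip {r} true dr ox oy oz x≺y y≺z ex ey ez with monotone r dr
  ... | inj₁ up   = not-¬ (up ox oy x≺y ex) ey
  ... | inj₂ down = not-¬ (down oy oz y≺z ez) ey
  no-dip {r} false dr ox oy oz x≺y y≺z ex ey ez with monotone r dr
  ... | inj₁ up   = not-¬ (up oy oz y≺z ey) ez
  ... | inj₂ down = not-¬ (down ox oy x≺y ey) ex

  -- A false entry w of row y lies below x, and row w then reads true, false, true at x, y, z.
  up-between-downs : Dom x → Dom y → Dom z → x ≺ y → y ≺ z →
                     Down x → Up y → Attains false y → Down z → entry x y ≡ true → ⊥
  up-between-downs dx dy dz x≺y y≺z down-x up-y (w , (dw , w≢y) , eyw) down-z exy =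
    no-dip true dw (dx , ≻⇒≢ w≺x) (dy , ≻⇒≢ w≺y) (dz , ≻⇒≢ (≺-trans w≺y y≺z))
      x≺y y≺z ewx (transpose eyw) ewz
    where
    eyx = transpose exy
    w≺x = up-false-below up-y (dx , ≺⇒≢ x≺y) (dw , w≢y) eyx eyw
    w≺y = ≺-trans w≺x x≺y
    ewx = transpose (down-x (dw , ≺⇒≢ w≺x) (dy , ≻⇒≢ x≺y) w≺y exy)
    eyz = up-y (dx , ≺⇒≢ x≺y) (dz , ≻⇒≢ y≺z) (≺-trans x≺y y≺z) eyx
    ewz = transpose
            (down-z (dw , ≺⇒≢ (≺-trans w≺y y≺z)) (dy , ≺⇒≢ y≺z) w≺y (transpose eyz))

  full-row-dip : Dom x → Dom y → Dom z → Dom h → x ≺ y → y ≺ z → y ≺ h → h ≢ z →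
                 Constant true y → entry x h ≡ false → entry z h ≡ false → ⊥
  full-row-dip dx dy dz dh x≺y y≺z y≺h h≢z full-y exh ezh =
    no-dip false dh (dx , ≺⇒≢ (≺-trans x≺y y≺h)) (dy , ≺⇒≢ y≺h) (dz , h≢z ∘ sym)
      x≺y y≺z (transpose exh) (transpose (full-y (dh , ≻⇒≢ y≺h))) (transpose ezh)

  -- The false entries of rows x and z lie above y; both rows are false at the larger of them.
  full-between-suffixes : Dom x → Dom y → Dom z → x ≺ y → y ≺ z →
                          Suffix x → Constant true y → Suffix z → ⊥
  full-between-suffixes {x} {y} {z} dx dy dz x≺y y≺z (down-x , mixed-x) full-y (down-z , mixed-z)
    with mixed-x false | mixed-z false
  ... | f , (df , f≢x) , exf | g , (dg , g≢z) , ezg = dip-at-larger (compare f g)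
    where
    dip : ∀ {h} → Dom h → y ≺ h → h ≢ z → entry x h ≡ false → entry z h ≡ false → ⊥
    dip dh y≺h h≢z = full-row-dip dx dy dz dh x≺y y≺z y≺h h≢z full-y
    exy = transpose (full-y (dx , ≺⇒≢ x≺y))
    ezy = transpose (full-y (dz , ≻⇒≢ y≺z))
    exz = transpose (down-z (dx , ≺⇒≢ (≺-trans x≺y y≺z)) (dy , ≺⇒≢ y≺z) x≺y ezy)
    y≺f = down-false-above down-x (dy , ≻⇒≢ x≺y) (df , f≢x) exy exf
    y≺g = down-false-above down-z (dy , ≺⇒≢ y≺z) (dg , g≢z) ezy ezg
    f≢z : f ≢ z
    f≢z refl = not-¬ exz exf
    g≢x : g ≢ x
    g≢x = ≻⇒≢ (≺-trans x≺y y≺g)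
    dip-at-larger : Tri (f ≺ g) (f ≡ g) (g ≺ f) → ⊥
    dip-at-larger (tri< f≺g _ _) =
      dip dg y≺g g≢z (down-false down-x (df , f≢x) (dg , g≢x) f≺g exf) ezg
    dip-at-larger (tri≈ _ f≡g _) =
      dip dg y≺g g≢z (subst (λ h → entry x h ≡ false) f≡g exf) ezg
    dip-at-larger (tri> _ _ g≺f) =
      dip df y≺f f≢z exf (down-false down-z (dg , g≢z) (df , f≢z) g≺f ezg)

module Peaks {A : Set} {_≺_ : Rel A 0ℓ} (sto : IsStrictTotalOrder _≡_ _≺_)
  {Dom : A → Set} {entry : A → A → Bool}
  (entry-sym : ∀ x y → entry x y ≡ entry y x)
  (monotone : Rows.RowsMonotone _≺_ Dom entry) where

  open Rows _≺_ Dom entry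
  open Duality _≺_ Dom entry
  open RowLemmas sto entry-sym monotone public
  open IsStrictTotalOrder sto using () renaming (trans to ≺-trans)
  private
    module Reversed =
      RowLemmas (Flip.isStrictTotalOrder sto) (symmetricᶜ entry-sym) (monotoneʳ monotone)

  private variable
    b : Bool
    x y z : A

  no-prefix-peak : Dom x → Dom y → Dom z → x ≺ y → y ≺ z → Down x → Prefix y → Down z → ⊥
  no-prefix-peak {x} {y} {z} dx dy dz x≺y y≺z down-x (up-y , mixed-y) down-z
    with entry x y in exy
  ... | true = up-between-downs dx dy dz x≺y y≺z down-x up-y (mixed-y false) down-z exy
  ... | false =
    Reversed.up-between-downs dz dy dx y≺z x≺y (down⇒downʳ down-z) (up⇒upʳ up-y)
      (mixedᶜ mixed-y false) (down⇒downʳ down-x) (cong not ezy)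
    where
    exz = down-false down-x (dy , ≻⇒≢ x≺y) (dz , ≻⇒≢ (≺-trans x≺y y≺z)) y≺z exy
    ezy = down-false down-z (dx , ≺⇒≢ (≺-trans x≺y y≺z)) (dy , ≺⇒≢ y≺z) x≺y
            (transpose exz)

  no-constant-peak : Dom x → Dom y → Dom z → x ≺ y → y ≺ z →
                     Suffix x → Constant b y → Suffix z → ⊥
  no-constant-peak {b = true} dx dy dz x≺y y≺z sx cy sz =
    full-between-suffixes dx dy dz x≺y y≺z sx cy sz
  no-constant-peak {b = false} dx dy dz x≺y y≺z sx cy sz =
    Reversed.full-between-suffixes dz dy dx y≺z x≺y
      (suffix⇒suffixʳ sz) (constantᶜ cy) (suffix⇒suffixʳ sx)

module Classification {A : Set} {_≺_ : Rel A 0ℓ} (sto : IsStrictTotalOrder _≡_ _≺_)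
  {Dom : A → Set} {entry : A → A → Bool}
  (entry-sym : ∀ x y → entry x y ≡ entry y x)
  (monotone : Rows.RowsMonotone _≺_ Dom entry) where

  open Rows _≺_ Dom entry
  open Duality _≺_ Dom entry
  open Peaks sto entry-sym monotone public
  private
    module Complemented = Peaks sto (symmetricᶜ entry-sym) (monotoneᶜ monotone)

  private variable
    b : Bool
    i j l : ℕ
    r x y z : A

  no-suffix-valley : Dom x → Dom y → Dom z → x ≺ y → y ≺ z → Up x → Suffix y → Up z → ⊥
  no-suffix-valley dx dy dz x≺y y≺z up-x sy up-z =
    Complemented.no-prefix-peak dx dy dz x≺y y≺z
      (up⇒downᶜ up-x) (suffix⇒prefixᶜ sy) (up⇒downᶜ up-z)

  no-constant-valley : Dom x → Dom y → Dom z → x ≺ y → y ≺ z →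
                       Prefix x → Constant b y → Prefix z → ⊥
  no-constant-valley dx dy dz x≺y y≺z px cy pz =
    Complemented.no-constant-peak dx dy dz x≺y y≺z
      (prefix⇒suffixᶜ px) (constantᶜ cy) (prefix⇒suffixᶜ pz)

  kind-suffix : Kind r i → i < 1 → Suffix r
  kind-suffix (suffix s) _ = s
  kind-suffix (constant _ _) (s≤s ())
  kind-suffix (prefix _) (s≤s ())

  kind-down : Kind r i → i < 2 → Down r
  kind-down (suffix (down , _)) _ = down
  kind-down (constant _ c) _ = constant⇒down c
  kind-down (prefix _) (s≤s (s≤s ()))

  kind-prefix : Kind r i → 1 < i → Prefix r
  kind-prefix (constant _ _) (s≤s ())
  kind-prefix (prefix p) _ = p

  kind-up : Kind r i → 0 < i → Up r
  kind-up (suffix _) ()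
  kind-up (constant _ c) _ = constant⇒up c
  kind-up (prefix (up , _)) _ = up

  kind-≤2 : Kind r i → i ≤ 2
  kind-≤2 (suffix _) = z≤n
  kind-≤2 (constant _ _) = s≤s z≤n
  kind-≤2 (prefix _) = s≤s (s≤s z≤n)

  kind-no-peak : Dom x → Dom y → Dom z → x ≺ y → y ≺ z →
                 Kind x i → Kind y j → Kind z l → i < j → l < j → ⊥
  kind-no-peak dx dy dz x≺y y≺z kx (constant _ cy) kz i<j l<j =
    no-constant-peak dx dy dz x≺y y≺z (kind-suffix kx i<j) cy (kind-suffix kz l<j)
  kind-no-peak dx dy dz x≺y y≺z kx (prefix py) kz i<j l<j =
    no-prefix-peak dx dy dz x≺y y≺z (kind-down kx i<j) py (kind-down kz l<j)

  kind-no-valley : Dom x → Dom y → Dom z → x ≺ y → y ≺ z →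
                   Kind x i → Kind y j → Kind z l → j < i → j < l → ⊥
  kind-no-valley dx dy dz x≺y y≺z kx (suffix sy) kz j<i j<l =
    no-suffix-valley dx dy dz x≺y y≺z (kind-up kx j<i) sy (kind-up kz j<l)
  kind-no-valley dx dy dz x≺y y≺z kx (constant _ cy) kz j<i j<l =
    no-constant-valley dx dy dz x≺y y≺z (kind-prefix kx j<i) cy (kind-prefix kz j<l)
  kind-no-valley _ _ _ _ _ kx (prefix _) _ j<i _ = ≤⇒≯ (kind-≤2 kx) j<i

  suffix-kind : Suffix r → Kind r i → i ≡ 0
  suffix-kind _ (suffix _) = refl
  suffix-kind (_ , mixed) (constant _ c) = ⊥-elim (mixed-not-constant mixed c)
  suffix-kind (down , mixed) (prefix (up , _)) = ⊥-elim (up-down-not-mixed up down mixed)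

  constant-kind : Constant b r → Kind r i → i ≡ 1
  constant-kind c (suffix (_ , mixed)) = ⊥-elim (mixed-not-constant mixed c)
  constant-kind _ (constant _ _) = refl
  constant-kind c (prefix (_ , mixed)) = ⊥-elim (mixed-not-constant mixed c)

  prefix-kind : Prefix r → Kind r i → i ≡ 2
  prefix-kind (up , mixed) (suffix (down , _)) = ⊥-elim (up-down-not-mixed up down mixed)
  prefix-kind (_ , mixed) (constant _ c) = ⊥-elim (mixed-not-constant mixed c)
  prefix-kind _ (prefix _) = refl

module Monotonicity {A : Set} {_≺_ : Rel A 0ℓ} (sto : IsStrictTotalOrder _≡_ _≺_)
  (xs : List A) (f : A → ℕ) where

  open IsStrictTotalOrder sto using (compare; _<?_) renaming (trans to ≺-trans)

  NoPeak NoValley Nondecreasing Nonincreasing : Set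
  NoPeak = ∀ {x y z} → x ∈ xs → y ∈ xs → z ∈ xs → x ≺ y → y ≺ z → f x < f y → f y ≤ f z
  NoValley = ∀ {x y z} → x ∈ xs → y ∈ xs → z ∈ xs → x ≺ y → y ≺ z → f y < f x → f z ≤ f y
  Nondecreasing = ∀ {x y} → x ∈ xs → y ∈ xs → x ≺ y → f x ≤ f y
  Nonincreasing = ∀ {x y} → x ∈ xs → y ∈ xs → x ≺ y → f y ≤ f x

  nondecreasing-order : Nondecreasing → ∀ {x y} → x ∈ xs → y ∈ xs → f y < f x → y ≺ x
  nondecreasing-order mono {x} {y} x∈ y∈ fy<fx with compare x y
  ... | tri< x≺y _ _ = contradiction (mono x∈ y∈ x≺y) (<⇒≱ fy<fx)
  ... | tri≈ _ refl _ = contradiction fy<fx (<-irrefl refl)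
  ... | tri> _ _ y≺x = y≺x

  nonincreasing-order : Nonincreasing → ∀ {x y} → x ∈ xs → y ∈ xs → f x < f y → y ≺ x
  nonincreasing-order mono {x} {y} x∈ y∈ fx<fy with compare x y
  ... | tri< x≺y _ _ = contradiction (mono x∈ y∈ x≺y) (<⇒≱ fx<fy)
  ... | tri≈ _ refl _ = contradiction fx<fy (<-irrefl refl)
  ... | tri> _ _ y≺x = y≺x

  module _ (no-peak : NoPeak) (no-valley : NoValley) where

    no-rise-and-fall-into : ∀ {a c e} → a ∈ xs → c ∈ xs → e ∈ xs →
                            a ≺ e → f a < f e → c ≺ e → f e < f c → ⊥
    no-rise-and-fall-into {a} {c} a∈ c∈ e∈ a≺e fa<fe c≺e fe<fc with compare a c
    ... | tri< a≺c _ _ = <⇒≱ fe<fc (no-peak a∈ c∈ e∈ a≺c c≺e (<-trans fa<fe fe<fc))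
    ... | tri≈ _ refl _ = <-asym fa<fe fe<fc
    ... | tri> _ _ c≺a = <⇒≱ fa<fe (no-valley c∈ a∈ e∈ c≺a a≺e (<-trans fa<fe fe<fc))

    -- Both pairs are first extended to end at the larger of b and d.
    no-rise-and-fall : ∀ {a b c d} → a ∈ xs → b ∈ xs → c ∈ xs → d ∈ xs →
                       a ≺ b → f a < f b → c ≺ d → f d < f c → ⊥
    no-rise-and-fall {b = b} {d = d} a∈ b∈ c∈ d∈ a≺b fa<fb c≺d fd<fc with compare b d
    ... | tri< b≺d _ _ =
      no-rise-and-fall-into a∈ c∈ d∈ (≺-trans a≺b b≺d)
        (<-≤-trans fa<fb (no-peak a∈ b∈ d∈ a≺b b≺d fa<fb)) c≺d fd<fc
    ... | tri≈ _ refl _ = no-rise-and-fall-into a∈ c∈ d∈ a≺b fa<fb c≺d fd<fc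
    ... | tri> _ _ d≺b =
      no-rise-and-fall-into a∈ c∈ b∈ a≺b fa<fb (≺-trans c≺d d≺b)
        (≤-<-trans (no-valley c∈ d∈ b∈ c≺d d≺b fd<fc) fd<fc)

    nondecreasing-or-nonincreasing : Nondecreasing ⊎ Nonincreasing
    nondecreasing-or-nonincreasing
      with any? (λ x → any? (λ y → x <? y ×-dec f x <ℕ? f y) xs) xs
    ... | yes rise with find rise
    ...   | a , a∈ , rise-from-a with find rise-from-a
    ...     | b , b∈ , a≺b , fa<fb =
      inj₁ λ x∈ y∈ x≺y → ≮⇒≥ λ fy<fx →
        no-rise-and-fall a∈ b∈ x∈ y∈ a≺b fa<fb x≺y fy<fx
    nondecreasing-or-nonincreasing | no no-rise =
      inj₂ λ x∈ y∈ x≺y → ≮⇒≥ λ fx<fy → no-rise (lose x∈ (lose y∈ (x≺y , fx<fy)))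

private variable
  x y : ℕ
  xs ys : List ℕ

Sorted : List ℕ → Set
Sorted = AllPairs _<_

sorted : Linked _<_ xs → Sorted xs
sorted = Linked.Linked⇒AllPairs <-trans

_≢?_ : ∀ x y → Dec (x ≢ y)
x ≢? y = ¬? (x ≟ y)

infixl 6 _∖_
_∖_ : List ℕ → ℕ → List ℕ
xs ∖ y = filter (_≢? y) xs

∈-∖⁺ : x ∈ xs × x ≢ y → x ∈ xs ∖ y
∈-∖⁺ (x∈xs , x≢y) = ∈-filter⁺ (_≢? _) x∈xs x≢y

∈-∖⁻ : x ∈ xs ∖ y → x ∈ xs × x ≢ y
∈-∖⁻ = ∈-filter⁻ (_≢? _)

∈-tail : x ∈ y ∷ ys → y < x → x ∈ ys
∈-tail (here refl) y<y = contradiction y<y (<-irrefl refl)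
∈-tail (there x∈ys) _ = x∈ys

∷-∖-head : (y ∷ ys) ∖ y ≡ ys ∖ y
∷-∖-head {y} = filter-reject (_≢? y) λ y≢y → y≢y refl

∷-∖-tail : x ≢ y → (x ∷ xs) ∖ y ≡ x ∷ xs ∖ y
∷-∖-tail {y = y} = filter-accept (_≢? y)

∖-fresh : All (y <_) ys → ys ∖ y ≡ ys
∖-fresh {y} y<ys = filter-all (_≢? y) (All.map >⇒≢ y<ys)

∖-comm : ∀ xs x y → xs ∖ x ∖ y ≡ xs ∖ y ∖ x
∖-comm [] x y = refl
∖-comm (z ∷ zs) x y with z ≟ x | z ≟ y
... | yes refl | yes refl = refl
... | yes refl | no z≢y
  rewrite ∷-∖-head {z} {zs} | ∷-∖-tail {xs = zs} z≢y | ∷-∖-head {z} {zs ∖ y} = ∖-comm zs z y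
... | no z≢x | yes refl
  rewrite ∷-∖-head {z} {zs} | ∷-∖-tail {xs = zs} z≢x | ∷-∖-head {z} {zs ∖ x} = ∖-comm zs x z
... | no z≢x | no z≢y
  rewrite ∷-∖-tail {xs = zs} z≢x | ∷-∖-tail {xs = zs ∖ x} z≢y
        | ∷-∖-tail {xs = zs} z≢y | ∷-∖-tail {xs = zs ∖ y} z≢x = cong (z ∷_) (∖-comm zs x y)

length-∖ : Sorted xs → y ∈ xs → suc (length (xs ∖ y)) ≡ length xs
length-∖ {x ∷ xs} (x<xs ∷ _) (here refl) =
  cong (suc ∘ length) (trans (∷-∖-head {x} {xs}) (∖-fresh x<xs))
length-∖ (x<xs ∷ s) (there y∈xs) =
  trans (cong (suc ∘ length) (∷-∖-tail (<⇒≢ (All.lookup x<xs y∈xs))))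
        (cong suc (length-∖ s y∈xs))

removal∈P : ∀ {n m X} → Comb n (suc m) X → y ∈ X → InP n m X (X ∖ y)
removal∈P (increasing , bounded , len) y∈X =
  ( Linked.filter⁺ (_≢? _) <-trans increasing
  , All.filter⁺ (_≢? _) bounded
  , suc-injective (trans (length-∖ (sorted increasing) y∈X) len))
  , λ _ z∈ → proj₁ (∈-∖⁻ z∈)

sorted-⊆⇒⊑ : Sorted xs → Sorted ys → (∀ z → z ∈ xs → z ∈ ys) → xs ⊑ ys
sorted-⊆⇒⊑ {[]} {ys} _ _ _ = minimum ys
sorted-⊆⇒⊑ {x ∷ xs} {[]} _ _ xs⊆ys with xs⊆ys x (here refl)
... | ()
sorted-⊆⇒⊑ {x ∷ xs} {y ∷ ys} (x<xs ∷ sx) (y<ys ∷ sy) xs⊆ys with xs⊆ys x (here refl)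
... | here refl =
  refl ∷ sorted-⊆⇒⊑ sx sy λ z z∈xs → ∈-tail (xs⊆ys z (there z∈xs)) (All.lookup x<xs z∈xs)
... | there x∈ys =
  y ∷ʳ sorted-⊆⇒⊑ (x<xs ∷ sx) sy λ z z∈ → ∈-tail (xs⊆ys z z∈) (y<all z∈)
  where
  y<x = All.lookup y<ys x∈ys
  y<all : ∀ {z} → z ∈ x ∷ xs → y < z
  y<all (here refl) = y<x
  y<all (there z∈xs) = <-trans y<x (All.lookup x<xs z∈xs)

⊑-one-shorter⇒removal : Sorted ys → xs ⊑ ys → suc (length xs) ≡ length ys →
                        ∃ λ y → y ∈ ys × xs ≡ ys ∖ y
⊑-one-shorter⇒removal {y ∷ ys} (y<ys ∷ _) (y ∷ʳ xs⊑ys) len =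
  y , here refl ,
  trans (≋⇒≡ (to-≋ (suc-injective len) xs⊑ys)) (sym (trans (∷-∖-head {y} {ys}) (∖-fresh y<ys)))
⊑-one-shorter⇒removal {y ∷ ys} (y<ys ∷ s) (refl ∷ xs⊑ys) len
  with ⊑-one-shorter⇒removal s xs⊑ys (suc-injective len)
... | w , w∈ys , xs≡ =
  w , there w∈ys , trans (cong (y ∷_) xs≡) (sym (∷-∖-tail (<⇒≢ (All.lookup y<ys w∈ys))))

∈P⇒removal : ∀ {n m X Z} → Comb n (suc m) X → InP n m X Z → ∃ λ x → x ∈ X × Z ≡ X ∖ x
∈P⇒removal (incX , _ , lenX) ((incZ , _ , lenZ) , Z⊆X) =
  ⊑-one-shorter⇒removal (sorted incX) (sorted-⊆⇒⊑ (sorted incZ) (sorted incX) Z⊆X)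
    (trans (cong suc lenZ) (sym lenX))

∖-lex : Sorted ys → x ∈ ys → y ∈ ys → x < y → (ys ∖ y) <L (ys ∖ x)
∖-lex _ (here refl) (here refl) x<x = contradiction x<x (<-irrefl refl)
∖-lex ([] ∷ _) (here refl) (there ())
∖-lex {z ∷ z′ ∷ zs} (z<zs@(z<z′ ∷ _) ∷ _) (here refl) (there _) z<y =
  subst₂ _<L_ (sym (∷-∖-tail (<⇒≢ z<y)))
    (sym (trans (∷-∖-head {z} {z′ ∷ zs}) (∖-fresh z<zs))) (here z<z′)
∖-lex (z<zs ∷ _) (there x∈zs) (here refl) x<z = contradiction x<z (<-asym (All.lookup z<zs x∈zs))
∖-lex (z<zs ∷ s) (there x∈zs) (there y∈zs) x<y =
  subst₂ _<L_ (sym (∷-∖-tail (<⇒≢ z<y))) (sym (∷-∖-tail (<⇒≢ z<x)))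
    (there (∖-lex s x∈zs y∈zs x<y))
  where
  z<x = All.lookup z<zs x∈zs
  z<y = <-trans z<x x<y

another-element : ∀ {m} → Linked _<_ xs → length xs ≡ suc (suc m) →
                  ∀ r → ∃ λ w → w ∈ xs × w ≢ r
another-element {x ∷ y ∷ _} (x<y ∷ _) _ r with x ≟ r
... | yes refl = y , there (here refl) , >⇒≢ x<y
... | no x≢r = x , here refl , x≢r

module _ {n k : ℕ} {J : Subset} {X : List ℕ} (cX : Comb n (suc k) X) where

  constant-or-attains : ∀ b → (∀ Z → InP n k X Z → J Z ≡ b)
                            ⊎ (∃ λ Z → InP n k X Z × J Z ≡ not b)
  constant-or-attains b with all? (λ x → J (X ∖ x) ≟ᵇ b) X
  ... | yes all≡b = inj₁ λ Z Z∈P → constant-at (∈P⇒removal cX Z∈P)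
    where
    constant-at : ∀ {Z} → ∃ (λ x → x ∈ X × Z ≡ X ∖ x) → J Z ≡ b
    constant-at (x , x∈X , refl) = All.lookup all≡b x∈X
  ... | no ¬all≡b with find (All.¬All⇒Any¬ (λ x → J (X ∖ x) ≟ᵇ b) X ¬all≡b)
  ...   | x , x∈X , Jx≢b = inj₂ (X ∖ x , removal∈P cX x∈X , ¬-not Jx≢b)

  realizable-classification : Realizable n k J →
                              Aₛ n k J X ⊎ Aₚ n k J X ⊎ A_F n k J X ⊎ A∅ n k J X
  realizable-classification realizable
    with constant-or-attains true | constant-or-attains false
  ... | inj₁ full | _ = inj₂ (inj₂ (inj₁ full))
  ... | inj₂ _ | inj₁ empty = inj₂ (inj₂ (inj₂ empty))
  ... | inj₂ some-false | inj₂ some-true with realizable X cX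
  ...   | inj₁ prefix = inj₂ (inj₁ (prefix , some-true , some-false))
  ...   | inj₂ suffix = inj₁ (suffix , some-true , some-false)

module RealizableRows {n k : ℕ} {J : Subset} (realizable : Realizable n k J)
  {Y : List ℕ} (cY : Comb n (suc (suc k)) Y) where

  -- Deleting a larger element leaves a lexicographically smaller set, so a prefix of P_{Y∖r}
  -- becomes an Up row r and a suffix a Down row.
  entry : ℕ → ℕ → Bool
  entry r w = J (Y ∖ r ∖ w)

  entry-sym : ∀ r w → entry r w ≡ entry w r
  entry-sym r w = cong J (∖-comm Y r w)

  open Rows _<_ (_∈ Y) entry

  private variable
    b : Bool
    r : ℕ

  row-comb : r ∈ Y → Comb n (suc k) (Y ∖ r)
  row-comb r∈Y = proj₁ (removal∈P cY r∈Y)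

  off-∈P : r ∈ Y → ∀ {w} → Off r w → InP n k (Y ∖ r) (Y ∖ r ∖ w)
  off-∈P r∈Y ow = removal∈P (row-comb r∈Y) (∈-∖⁺ ow)

  row-lex : r ∈ Y → ∀ {w w′} → Off r w → Off r w′ → w < w′ → (Y ∖ r ∖ w′) <L (Y ∖ r ∖ w)
  row-lex r∈Y ow ow′ = ∖-lex (sorted (proj₁ (row-comb r∈Y))) (∈-∖⁺ ow) (∈-∖⁺ ow′)

  prefix⇒up : r ∈ Y → IsPrefix n k J (Y ∖ r) → Up r
  prefix⇒up r∈Y is-prefix ow ow′ w<w′ =
    is-prefix _ _ (off-∈P r∈Y ow) (off-∈P r∈Y ow′) (row-lex r∈Y ow ow′ w<w′)

  suffix⇒down : r ∈ Y → IsSuffix n k J (Y ∖ r) → Down r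
  suffix⇒down r∈Y is-suffix ow ow′ w<w′ =
    is-suffix _ _ (off-∈P r∈Y ow′) (off-∈P r∈Y ow) (row-lex r∈Y ow ow′ w<w′)

  rows-monotone : RowsMonotone
  rows-monotone r r∈Y =
    Sum.map (prefix⇒up r∈Y) (suffix⇒down r∈Y) (realizable (Y ∖ r) (row-comb r∈Y))

  attains-row : r ∈ Y → (∃ λ Z → InP n k (Y ∖ r) Z × J Z ≡ b) → Attains b r
  attains-row r∈Y (Z , Z∈P , JZ≡b) with ∈P⇒removal (row-comb r∈Y) Z∈P
  ... | w , w∈ , refl = w , ∈-∖⁻ w∈ , JZ≡b

  constant-row : r ∈ Y → (∀ Z → InP n k (Y ∖ r) Z → J Z ≡ b) → Constant b r
  constant-row r∈Y all≡b ow = all≡b _ (off-∈P r∈Y ow)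

  mixed-row : r ∈ Y → NonEmptyIn n k J (Y ∖ r) → NotAllIn n k J (Y ∖ r) → Mixed r
  mixed-row r∈Y some-true some-false true = attains-row r∈Y some-true
  mixed-row r∈Y some-true some-false false = attains-row r∈Y some-false

  suffix-row : r ∈ Y → Aₛ n k J (Y ∖ r) → Suffix r
  suffix-row r∈Y (is-suffix , some-true , some-false) =
    suffix⇒down r∈Y is-suffix , mixed-row r∈Y some-true some-false

  prefix-row : r ∈ Y → Aₚ n k J (Y ∖ r) → Prefix r
  prefix-row r∈Y (is-prefix , some-true , some-false) =
    prefix⇒up r∈Y is-prefix , mixed-row r∈Y some-true some-false

  kind : r ∈ Y → ∃ (Kind r)
  kind r∈Y with realizable-classification (row-comb r∈Y) realizable
  ... | inj₁ s = 0 , suffix (suffix-row r∈Y s)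
  ... | inj₂ (inj₁ p) = 2 , prefix (prefix-row r∈Y p)
  ... | inj₂ (inj₂ (inj₁ full)) = 1 , constant true (constant-row r∈Y full)
  ... | inj₂ (inj₂ (inj₂ empty)) = 1 , constant false (constant-row r∈Y empty)

  -- Outside Y the rank is a junk value.
  rank : ℕ → ℕ
  rank r with r ∈? Y
  ... | yes r∈Y = proj₁ (kind r∈Y)
  ... | no _ = 0

  rank-kind : r ∈ Y → Kind r (rank r)
  rank-kind {r} r∈Y with r ∈? Y
  ... | yes r∈Y′ = proj₂ (kind r∈Y′)
  ... | no r∉Y = contradiction r∈Y r∉Y

  open Classification <-isStrictTotalOrder {Dom = _∈ Y} entry-sym rows-monotone
  open Monotonicity <-isStrictTotalOrder Y rank

  rank-monotone : Nondecreasing ⊎ Nonincreasing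
  rank-monotone = nondecreasing-or-nonincreasing no-peak no-valley
    where
    no-peak : NoPeak
    no-peak x∈ y∈ z∈ x<y y<z =
      ≮⇒≥ ∘ kind-no-peak x∈ y∈ z∈ x<y y<z (rank-kind x∈) (rank-kind y∈) (rank-kind z∈)
    no-valley : NoValley
    no-valley x∈ y∈ z∈ x<y y<z =
      ≮⇒≥ ∘ kind-no-valley x∈ y∈ z∈ x<y y<z (rank-kind x∈) (rank-kind y∈) (rank-kind z∈)

  RankIs : (List ℕ → Set) → ℕ → Set
  RankIs Q q = ∀ {r} → r ∈ Y → Q (Y ∖ r) → rank r ≡ q

  rank-suffix : RankIs (Aₛ n k J) 0
  rank-suffix r∈Y s = suffix-kind (suffix-row r∈Y s) (rank-kind r∈Y)

  rank-prefix : RankIs (Aₚ n k J) 2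
  rank-prefix r∈Y p = prefix-kind (prefix-row r∈Y p) (rank-kind r∈Y)

  rank-full : RankIs (A_F n k J) 1
  rank-full r∈Y full = constant-kind (constant-row r∈Y full) (rank-kind r∈Y)

  rank-empty : RankIs (A∅ n k J) 1
  rank-empty r∈Y empty = constant-kind (constant-row r∈Y empty) (rank-kind r∈Y)

  before : ∀ {Q R : List ℕ → Set} →
           (∀ {r r′} → r ∈ Y → r′ ∈ Y → Q (Y ∖ r) → R (Y ∖ r′) → r′ < r) →
           Before n (suc k) Y Q R
  before order X X′ X∈P X′∈P QX RX′ with ∈P⇒removal cY X∈P | ∈P⇒removal cY X′∈P
  ... | r , r∈Y , refl | r′ , r′∈Y , refl =
    ∖-lex (sorted (proj₁ cY)) r′∈Y r∈Y (order r∈Y r′∈Y QX RX′)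

  module _ {Q R : List ℕ → Set} {q q′ : ℕ} (rank-Q : RankIs Q q) (rank-R : RankIs R q′) where

    before-nonincreasing : Nonincreasing → q < q′ → Before n (suc k) Y Q R
    before-nonincreasing mono q<q′ = before λ r∈Y r′∈Y Qr Rr′ →
      nonincreasing-order mono r∈Y r′∈Y
        (subst₂ _<_ (sym (rank-Q r∈Y Qr)) (sym (rank-R r′∈Y Rr′)) q<q′)

    before-nondecreasing : Nondecreasing → q′ < q → Before n (suc k) Y Q R
    before-nondecreasing mono q′<q = before λ r∈Y r′∈Y Qr Rr′ →
      nondecreasing-order mono r∈Y r′∈Y
        (subst₂ _<_ (sym (rank-R r′∈Y Rr′)) (sym (rank-Q r∈Y Qr)) q′<q)

  module _ {Middle Absent : List ℕ → Set} (rank-middle : RankIs Middle 1)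
           (absent : ∀ X → InP n (suc k) Y X → ¬ Absent X) where

    arranged-nonincreasing : Nonincreasing →
                             Arranged n (suc k) Y (Aₛ n k J) Middle (Aₚ n k J) Absent
    arranged-nonincreasing mono =
      before-nonincreasing rank-suffix rank-middle mono z<s ,
      before-nonincreasing rank-middle rank-prefix mono (s<s z<s) ,
      before-nonincreasing rank-suffix rank-prefix mono z<s ,
      absent

    arranged-nondecreasing : Nondecreasing →
                             Arranged n (suc k) Y (Aₚ n k J) Middle (Aₛ n k J) Absent
    arranged-nondecreasing mono =
      before-nondecreasing rank-prefix rank-middle mono (s<s z<s) ,
      before-nondecreasing rank-middle rank-suffix mono z<s ,
      before-nondecreasing rank-prefix rank-suffix mono z<s ,
      absent

  full? : ∀ r → Dec (Constant true r)
  full? r = map′ (λ all≡true ow → All.lookup all≡true (proj₁ ow) (proj₂ ow))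
                 (λ full → All.tabulate λ w∈Y w≢r → full (w∈Y , w≢r))
                 (all? (λ w → w ≢? r →-dec entry r w ≟ᵇ true) Y)

  no-empty : Any (Constant true) Y → ∀ X → InP n (suc k) Y X → ¬ A∅ n k J X
  no-empty some-full X X∈P empty with find some-full | ∈P⇒removal cY X∈P
  ... | f , f∈Y , full-f | r , r∈Y , refl =
    full-empty-exclusive f∈Y r∈Y (another-element (proj₁ cY) (proj₂ (proj₂ cY)) f)
      full-f (constant-row r∈Y empty)

  no-full : ¬ Any (Constant true) Y → ∀ X → InP n (suc k) Y X → ¬ A_F n k J X
  no-full no-full-row X X∈P full with ∈P⇒removal cY X∈P
  ... | r , r∈Y , refl = no-full-row (lose r∈Y (constant-row r∈Y full))

  arrangement : Arranged n (suc k) Y (Aₛ n k J) (A_F n k J) (Aₚ n k J) (A∅ n k J)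
              ⊎ Arranged n (suc k) Y (Aₚ n k J) (A_F n k J) (Aₛ n k J) (A∅ n k J)
              ⊎ Arranged n (suc k) Y (Aₛ n k J) (A∅ n k J) (Aₚ n k J) (A_F n k J)
              ⊎ Arranged n (suc k) Y (Aₚ n k J) (A∅ n k J) (Aₛ n k J) (A_F n k J)
  arrangement with rank-monotone | any? full? Y
  ... | inj₂ mono | yes some-full =
    inj₁ (arranged-nonincreasing rank-full (no-empty some-full) mono)
  ... | inj₁ mono | yes some-full =
    inj₂ (inj₁ (arranged-nondecreasing rank-full (no-empty some-full) mono))
  ... | inj₂ mono | no no-full-row =
    inj₂ (inj₂ (inj₁ (arranged-nonincreasing rank-empty (no-full no-full-row) mono)))
  ... | inj₁ mono | no no-full-row =
    inj₂ (inj₂ (inj₂ (arranged-nondecreasing rank-empty (no-full no-full-row) mono)))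

lemma3p15 : (n k : ℕ) (J : Subset) → Realizable n k J →
    (Y : List ℕ) → Comb n (suc (suc k)) Y →
    (∀ X → InP n (suc k) Y X →
        Aₛ n k J X ⊎ Aₚ n k J X ⊎ A_F n k J X ⊎ A∅ n k J X)
    × (Arranged n (suc k) Y (Aₛ n k J) (A_F n k J) (Aₚ n k J) (A∅ n k J)
       ⊎ Arranged n (suc k) Y (Aₚ n k J) (A_F n k J) (Aₛ n k J) (A∅ n k J)
       ⊎ Arranged n (suc k) Y (Aₛ n k J) (A∅ n k J) (Aₚ n k J) (A_F n k J)
       ⊎ Arranged n (suc k) Y (Aₚ n k J) (A∅ n k J) (Aₛ n k J) (A_F n k J))
lemma3p15 n k J realizable Y cY =
  (λ X X∈P → realizable-classification (proj₁ X∈P) realizable) ,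
  RealizableRows.arrangement realizable cY
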